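{- Let $\epsilon>0$, let $G$ be a graph and $\mu$ a mass on $G$ such that (1) $\mu(\{v\})<\epsilon$ for every vertex $v$; (2) $\mu(N(v))<\epsilon$ for every vertex $v$; and (3) there do not exist two anticomplete sets $A,B\subseteq V(G)$ with $\mu(A),\mu(B)\ge\epsilon$. Let $\tau\ge 3$ be an integer and let $X\subseteq V(G)$ with $\mu(X)\ge(\tau+2)\epsilon$. Then there is a $\tau$-spire $(x_1,\ldots,x_\tau,Z)$ in $X$ with $\mu(Z)\ge\mu(X)-\tau\epsilon$.
   Context: All graphs are finite and simple. A mass on $G$ is a function assigning a real number $\mu(X)$ to every $X\subseteq V(G)$ such that $\mu(\emptyset)=0$, $\mu(V(G))=1$, $\mu(X)\le\mu(Y)$ whenever $X\subseteq Y$, and $\mu(X\cup Y)\le \mu(X)+\mu(Y)$ for all disjoint $X,Y$. $N(v)$ is the set of neighbours of $v$; two sets are anticomplete if they are disjoint with no edge between them. For $X\subseteq V(G)$ and an integer $\tau\ge3$, a $\tau$-spire in $X$ is a sequence $(x_1,\ldots,x_\tau,Z)$ such that: $x_1,\ldots,x_\tau$ are, in order, the vertices of an induced $\tau$-vertex path of $G[X]$; $Z\subseteq X\setminus\{x_1,\ldots,x_{\tau-1}\}$ and $x_\tau\in Z$; none of $x_1,\ldots,x_{\tau-1}$ has a neighbour in $Z\setminus\{x_\tau\}$; and $G[Z]$ is connected. -}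

module Defs where

open import Level using (Level; _⊔_) renaming (suc to lsuc)
open import Data.Nat as ℕ using (ℕ; zero; suc)
open import Data.Bool using (Bool; true; false; T)
open import Data.Fin using (Fin; toℕ)
open import Data.Fin.Subset using (Subset; _∈_; _∉_; _⊆_; _∪_; _∩_; Empty; ⊤; ⊥; ⁅_⁆)
open import Data.Vec using (tabulate)
open import Data.Product using (Σ; ∃; _×_; _,_)
open import Data.Sum using (_⊎_)
open import Relation.Nullary using (¬_)
open import Relation.Binary.PropositionalEquality using (_≡_; _≢_)
open import Relation.Binary.Structures using (IsStrictTotalOrder)
open import Algebra.Bundles using (CommutativeRing)

-- Ordered fields (the stdlib has no real numbers; masses are stated
-- over an arbitrary ordered field, of which ℝ is one instance).

record OrderedField (c ℓ₁ ℓ₂ : Level) : Set (lsuc (c ⊔ ℓ₁ ⊔ ℓ₂)) where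
  field
    commutativeRing : CommutativeRing c ℓ₁
  open CommutativeRing commutativeRing public
  infix 4 _<_ _≤_
  field
    _<_                : Carrier → Carrier → Set ℓ₂
    isStrictTotalOrder : IsStrictTotalOrder _≈_ _<_
    0<1                : 0# < 1#
    +-monoˡ-<          : ∀ {x y} z → x < y → x + z < y + z
    *-pos              : ∀ {x y} → 0# < x → 0# < y → 0# < x * y
    inverse            : ∀ x → ¬ (x ≈ 0#) → Σ Carrier λ y → x * y ≈ 1#

  _≤_ : Carrier → Carrier → Set (ℓ₁ ⊔ ℓ₂)
  x ≤ y = x < y ⊎ x ≈ y

  fromℕ : ℕ → Carrier
  fromℕ zero    = 0#
  fromℕ (suc k) = 1# + fromℕ k

record Graph (n : ℕ) : Set where
  field
    adj     : Fin n → Fin n → Bool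
    adj-sym : ∀ u v → adj u v ≡ adj v u
    adj-irr : ∀ v → adj v v ≡ false

  Edge : Fin n → Fin n → Set
  Edge u v = T (adj u v)

  N : Fin n → Subset n
  N v = tabulate (λ u → adj v u)

  Anticomplete : Subset n → Subset n → Set
  Anticomplete A B = Empty (A ∩ B) × (∀ a b → a ∈ A → b ∈ B → ¬ Edge a b)

  data ReachIn (Z : Subset n) : Fin n → Fin n → Set where
    here : ∀ {v} → v ∈ Z → ReachIn Z v v
    step : ∀ {u w v} → u ∈ Z → Edge u w → ReachIn Z w v → ReachIn Z u v

  Connected : Subset n → Set
  Connected Z = (∃ λ z → z ∈ Z) × (∀ u v → u ∈ Z → v ∈ Z → ReachIn Z u v)

  -- x : Fin τ → Fin n lists, in order, the vertices x₁,…,x_τ of an induced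
  -- τ-vertex path of G[X] (index i : Fin τ stands for x_{i+1}).
  IsInducedPathIn : (X : Subset n) (τ : ℕ) → (Fin τ → Fin n) → Set
  IsInducedPathIn X τ x =
      (∀ i → x i ∈ X)
    × (∀ i j → x i ≡ x j → i ≡ j)
    × (∀ i j → Edge (x i) (x j) → (suc (toℕ i) ≡ toℕ j ⊎ suc (toℕ j) ≡ toℕ i))
    × (∀ i j → suc (toℕ i) ≡ toℕ j → Edge (x i) (x j))

  record Spire (X : Subset n) (τ : ℕ) (x : Fin τ → Fin n) (Z : Subset n) : Set where
    field
      inducedPath : IsInducedPathIn X τ x
      Z⊆X         : Z ⊆ X
      notInZ      : ∀ i → suc (toℕ i) ℕ.< τ → x i ∉ Z
      lastInZ     : ∀ i → suc (toℕ i) ≡ τ → x i ∈ Z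
      noNbr       : ∀ i z → suc (toℕ i) ℕ.< τ → z ∈ Z
                    → (∀ j → suc (toℕ j) ≡ τ → z ≢ x j)
                    → ¬ Edge (x i) z
      connected   : Connected Z

record Mass {c ℓ₁ ℓ₂} (F : OrderedField c ℓ₁ ℓ₂) (n : ℕ) : Set (c ⊔ ℓ₁ ⊔ ℓ₂) where
  open OrderedField F
  field
    μ         : Subset n → Carrier
    μ-empty   : μ ⊥ ≈ 0#
    μ-full    : μ ⊤ ≈ 1#
    μ-mono    : ∀ X Y → X ⊆ Y → μ X ≤ μ Y
    μ-subadd  : ∀ X Y → Empty (X ∩ Y) → μ (X ∪ Y) ≤ μ X + μ Y

module Submission where

-- Write τ = t + 1.  We build, for j = 0, …, t, a "stage": an
-- induced path x₀ … x_j of G[X] and a connected Z ∋ x_j forming a spire, a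
-- set A of mass < ε anticomplete to Z ∖ {x_j}, and a set W of mass ≤ jε, with
-- X ⊆ A ∪ W ∪ Z.  The engine is the grouping lemma: if O has mass < 2ε and is
-- anticomplete to Y, then either some component of G[Y] has mass ≥ ε, or
-- O ∪ Y has mass < 3ε (components of mass < ε are moved into O one by one,
-- and once O reaches mass ε hypothesis (3) bounds the rest).  To extend a
-- stage, apply it to O = A ∪ {x_j} and Y = Z ∖ N[x_j]: the second outcome
-- would cover X by sets of mass < (j + 4)ε ≤ (τ + 2)ε; in the first, the
-- heavy component D is reached from x_j through a neighbour y ∈ Z, and
-- D ∪ {y} is the new Z while O ∪ (Y ∖ D) is the new A, light by (3).
-- At stage t the covering gives μ(X) < ε + tε + μ(Z) = τε + μ(Z).

open import Defs
open import Level using (Level; _⊔_)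
open import Data.Nat as ℕ using (ℕ; zero; suc; z≤n; s≤s)
import Data.Nat.Properties as ℕP
open import Data.Bool using (T)
open import Data.Bool.Properties using (T-≡)
open import Data.Fin as Fin using (Fin; toℕ)
open import Data.Fin.Properties using (any?; toℕ-injective; toℕ<n; toℕ-fromℕ) renaming (_≟_ to _≟ᶠ_)
open import Data.Fin.Subset using (Subset; inside; outside; _∈_; _∉_; _⊆_; _⊂_; _⊃_; _∪_; _∩_; _─_; Empty; ⁅_⁆)
  renaming (⊥ to ∅)
open import Data.Fin.Subset.Properties
  using (_∈?_; nonempty?; x∈p∪q⁺; x∈p∪q⁻; x∈p∩q⁺; x∈p∩q⁻; x∈⁅x⁆; x∈⁅y⁆⇒x≡y; p⊆p∪q; p─q⊆p;
         x∈p∧x∉q⇒x∈p─q; x∈p∧x≢y⇒x∈p-y; p∩q≢∅⇒p─q⊂p; ∉⊥)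
open import Data.Fin.Subset.Induction using (Acc; acc; ⊂-wellFounded; ⊃-wellFounded)
open import Data.Vec using (_∷_; here; there)
open import Data.Vec.Properties using (lookup⇒[]=; []=⇒lookup; lookup∘tabulate)
open import Data.Product using (Σ; _×_; _,_; proj₁; proj₂)
open import Data.Sum as Sum using (_⊎_; inj₁; inj₂)
open import Data.Empty using (⊥; ⊥-elim)
open import Function using (_∘_)
open import Function.Bundles using (Equivalence)
open import Relation.Nullary using (¬_; Dec; yes; no)
open import Relation.Nullary.Decidable using (T?; _×-dec_)
open import Relation.Binary.Bundles using (StrictTotalOrder)
open import Relation.Binary.Definitions using (tri<; tri≈; tri>)
import Relation.Binary.Construct.StrictToNonStrict as NonStrict
open import Relation.Binary.PropositionalEquality using (_≡_; _≢_; refl; sym; trans; cong; subst; subst₂)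

-- The relation _≤_ of OrderedField is by
-- definition the reflexive closure x < y ⊎ x ≈ y that the library derives
-- from a strict order, so the library's strict-order reasoning applies.
module OrderedFieldFacts {c ℓ₁ ℓ₂ : Level} (F : OrderedField c ℓ₁ ℓ₂) where
  open OrderedField F renaming (refl to ≈-refl; sym to ≈-sym; trans to ≈-trans)

  strictTotalOrder : StrictTotalOrder c ℓ₁ ℓ₂
  strictTotalOrder = record { isStrictTotalOrder = isStrictTotalOrder }

  open StrictTotalOrder strictTotalOrder using (strictPartialOrder; compare; <-resp-≈; <-respˡ-≈)
    renaming (trans to <-trans; irrefl to <-irrefl)
  open import Relation.Binary.Reasoning.StrictPartialOrder strictPartialOrder public

  <-or-≥ : ∀ x y → x < y ⊎ y ≤ x
  <-or-≥ x y with compare x y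
  ... | tri< x<y _ _ = inj₁ x<y
  ... | tri≈ _ x≈y _ = inj₂ (inj₂ (≈-sym x≈y))
  ... | tri> _ _ y<x = inj₂ (inj₁ y<x)

  ≤-<-trans : ∀ {x y z} → x ≤ y → y < z → x < z
  ≤-<-trans = NonStrict.≤-<-trans _≈_ _<_ ≈-sym <-trans <-respˡ-≈

  ≤-trans : ∀ {x y z} → x ≤ y → y ≤ z → x ≤ z
  ≤-trans = NonStrict.trans _≈_ _<_ isEquivalence <-resp-≈ <-trans

  ≤-<-contradiction : ∀ {x y} → x ≤ y → y < x → ⊥
  ≤-<-contradiction x≤y y<x = <-irrefl ≈-refl (≤-<-trans x≤y y<x)

  +-monoʳ-< : ∀ {x y} z → x < y → z + x < z + y
  +-monoʳ-< {x} {y} z x<y = begin-strict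
    z + x  ≈⟨ +-comm z x ⟩
    x + z  <⟨ +-monoˡ-< z x<y ⟩
    y + z  ≈⟨ +-comm y z ⟩
    z + y  ∎

  +-mono-<-≤ : ∀ {a b c d} → a < b → c ≤ d → a + c < b + d
  +-mono-<-≤ {a} {b} {c} {d} a<b c≤d = begin-strict
    a + c  <⟨ +-monoˡ-< c a<b ⟩
    b + c  ≤⟨ lemma c≤d ⟩
    b + d  ∎
    where
    lemma : c ≤ d → b + c ≤ b + d
    lemma (inj₁ c<d) = inj₁ (+-monoʳ-< b c<d)
    lemma (inj₂ c≈d) = inj₂ (+-cong ≈-refl c≈d)

  +-mono-≤-< : ∀ {a b c d} → a ≤ b → c < d → a + c < b + d
  +-mono-≤-< {a} {b} {c} {d} a≤b c<d = begin-strict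
    a + c  ≈⟨ +-comm a c ⟩
    c + a  <⟨ +-mono-<-≤ c<d a≤b ⟩
    d + b  ≈⟨ +-comm d b ⟩
    b + d  ∎

  +-mono-≤ : ∀ {a b c d} → a ≤ b → c ≤ d → a + c ≤ b + d
  +-mono-≤ (inj₁ a<b) c≤d       = inj₁ (+-mono-<-≤ a<b c≤d)
  +-mono-≤ (inj₂ a≈b) (inj₁ c<d) = inj₁ (+-mono-≤-< (inj₂ a≈b) c<d)
  +-mono-≤ (inj₂ a≈b) (inj₂ c≈d) = inj₂ (+-cong a≈b c≈d)

  <-+⇒-< : ∀ {a b c} → a < b + c → a - b < c
  <-+⇒-< {a} {b} {c} a<b+c = begin-strict
    a - b          <⟨ +-monoˡ-< (- b) a<b+c ⟩
    (b + c) - b    ≈⟨ +-cong (+-comm b c) ≈-refl ⟩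
    (c + b) - b    ≈⟨ +-assoc c b (- b) ⟩
    c + (b - b)    ≈⟨ +-cong ≈-refl (-‿inverseʳ b) ⟩
    c + 0#         ≈⟨ +-identityʳ c ⟩
    c              ∎

  module Multiples (ε : Carrier) where
    infix 8 _·ε
    _·ε : ℕ → Carrier
    k ·ε = fromℕ k * ε

    ·ε-zero : 0 ·ε ≈ 0#
    ·ε-zero = zeroˡ ε

    ·ε-suc : ∀ k → suc k ·ε ≈ ε + k ·ε
    ·ε-suc k = begin-equality
      (1# + fromℕ k) * ε  ≈⟨ distribʳ ε 1# (fromℕ k) ⟩
      1# * ε + k ·ε       ≈⟨ +-cong (*-identityˡ ε) ≈-refl ⟩
      ε + k ·ε            ∎

    ·ε-sucʳ : ∀ k → k ·ε + ε ≈ suc k ·ε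
    ·ε-sucʳ k = ≈-trans (+-comm (k ·ε) ε) (≈-sym (·ε-suc k))

    ·ε-+ : ∀ a b → (a ℕ.+ b) ·ε ≈ a ·ε + b ·ε
    ·ε-+ zero    b = begin-equality
      b ·ε            ≈⟨ +-identityˡ (b ·ε) ⟨
      0# + b ·ε       ≈⟨ +-cong ·ε-zero ≈-refl ⟨
      0 ·ε + b ·ε     ∎
    ·ε-+ (suc a) b = begin-equality
      suc (a ℕ.+ b) ·ε        ≈⟨ ·ε-suc (a ℕ.+ b) ⟩
      ε + (a ℕ.+ b) ·ε        ≈⟨ +-cong ≈-refl (·ε-+ a b) ⟩
      ε + (a ·ε + b ·ε)       ≈⟨ +-assoc ε (a ·ε) (b ·ε) ⟨
      (ε + a ·ε) + b ·ε       ≈⟨ +-cong (·ε-suc a) ≈-refl ⟨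
      suc a ·ε + b ·ε         ∎

    ·ε-one : 1 ·ε ≈ ε
    ·ε-one = begin-equality
      1 ·ε       ≈⟨ ·ε-suc 0 ⟩
      ε + 0 ·ε   ≈⟨ +-cong ≈-refl ·ε-zero ⟩
      ε + 0#     ≈⟨ +-identityʳ ε ⟩
      ε          ∎

    ε+ε≈2ε : ε + ε ≈ 2 ·ε
    ε+ε≈2ε = ≈-trans (+-cong (≈-sym ·ε-one) ≈-refl) (·ε-sucʳ 1)

    ·ε-mono : 0# < ε → ∀ {a b} → a ℕ.≤ b → a ·ε ≤ b ·ε
    ·ε-mono ε>0 {a} {b} a≤b = go (ℕP.≤⇒≤′ a≤b)
      where
      go : ∀ {k} → a ℕ.≤′ k → a ·ε ≤ k ·ε
      go ℕ.≤′-refl = inj₂ ≈-refl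
      go (ℕ.≤′-step {k} a≤′k) = begin
        a ·ε        ≤⟨ go a≤′k ⟩
        k ·ε        ≈⟨ +-identityˡ (k ·ε) ⟨
        0# + k ·ε   <⟨ +-monoˡ-< (k ·ε) ε>0 ⟩
        ε + k ·ε    ≈⟨ ·ε-suc k ⟨
        suc k ·ε    ∎

x∈p─q⁻ : ∀ {n} (p q : Subset n) {x} → x ∈ p ─ q → x ∈ p × x ∉ q
x∈p─q⁻ (inside ∷ p)  (outside ∷ q) here      = here , λ ()
x∈p─q⁻ (outside ∷ p) (outside ∷ q) {Fin.zero} ()
x∈p─q⁻ (outside ∷ p) (inside ∷ q)  {Fin.zero} ()
x∈p─q⁻ (_ ∷ p)      (_ ∷ q)       (there x∈) with x∈p─q⁻ p q x∈
... | x∈p , x∉q = there x∈p , λ { (there x∈q) → x∉q x∈q }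

∪-transfer : ∀ {n} (O Y C : Subset n) → O ∪ Y ⊆ (O ∪ C) ∪ (Y ─ C)
∪-transfer O Y C {u} u∈ with x∈p∪q⁻ O Y u∈ | u ∈? C
... | inj₁ u∈O | _       = x∈p∪q⁺ (inj₁ (x∈p∪q⁺ (inj₁ u∈O)))
... | inj₂ _   | yes u∈C = x∈p∪q⁺ (inj₁ (x∈p∪q⁺ (inj₂ u∈C)))
... | inj₂ u∈Y | no  u∉C = x∈p∪q⁺ (inj₂ (x∈p∧x∉q⇒x∈p─q u∈Y u∉C))

module GraphFacts {n : ℕ} (G : Graph n) where
  open Graph G
  open import Data.Nat using (_≤_; _<_)

  private
    variable
      a b u v w x y z : Fin n
      A B C D Y Z : Subset n

  Edge-sym : Edge u v → Edge v u
  Edge-sym {u} {v} = subst T (adj-sym u v)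

  Edge-irrefl : ¬ Edge v v
  Edge-irrefl {v} = subst T (adj-irr v)

  Edge? : ∀ u v → Dec (Edge u v)
  Edge? u v = T? (adj u v)

  ∈N⁺ : Edge v u → u ∈ N v
  ∈N⁺ {v} {u} e = lookup⇒[]= u (N v) (trans (lookup∘tabulate (adj v) u) (Equivalence.to T-≡ e))

  ∈N⁻ : u ∈ N v → Edge v u
  ∈N⁻ {u} {v} u∈ = Equivalence.from T-≡ (trans (sym (lookup∘tabulate (adj v) u)) ([]=⇒lookup u∈))

  N[_] : Fin n → Subset n
  N[ x ] = ⁅ x ⁆ ∪ N x

  far⁺ : w ∈ Z → w ≢ x → ¬ Edge x w → w ∈ Z ─ N[ x ]
  far⁺ {w} {Z} {x} w∈Z w≢x ¬e = x∈p∧x∉q⇒x∈p─q w∈Z notNear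
    where
    notNear : w ∉ N[ x ]
    notNear w∈ with x∈p∪q⁻ ⁅ x ⁆ (N x) w∈
    ... | inj₁ w∈⁅x⁆ = w≢x (x∈⁅y⁆⇒x≡y x w∈⁅x⁆)
    ... | inj₂ w∈Nx  = ¬e (∈N⁻ w∈Nx)

  far⁻ : w ∈ Z ─ N[ x ] → w ∈ Z × w ≢ x × ¬ Edge x w
  far⁻ {w} {Z} {x} w∈ with x∈p─q⁻ Z N[ x ] w∈
  ... | w∈Z , w∉N[x] =
    w∈Z , (λ { refl → w∉N[x] (x∈p∪q⁺ (inj₁ (x∈⁅x⁆ w))) }) , (λ e → w∉N[x] (x∈p∪q⁺ (inj₂ (∈N⁺ e))))

  reach-start : ReachIn Z u v → u ∈ Z
  reach-start (here u∈Z)     = u∈Z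
  reach-start (step u∈Z _ _) = u∈Z

  reach-trans : ReachIn Z u v → ReachIn Z v w → ReachIn Z u w
  reach-trans (here _)       r′ = r′
  reach-trans (step u∈Z e r) r′ = step u∈Z e (reach-trans r r′)

  reach-sym : ReachIn Z u v → ReachIn Z v u
  reach-sym (here v∈Z)       = here v∈Z
  reach-sym (step u∈Z e r) =
    reach-trans (reach-sym r) (step (reach-start r) (Edge-sym e) (here u∈Z))

  reach-mono : Z ⊆ Y → ReachIn Z u v → ReachIn Y u v
  reach-mono Z⊆Y (here v∈Z)     = here (Z⊆Y v∈Z)
  reach-mono Z⊆Y (step u∈Z e r) = step (Z⊆Y u∈Z) e (reach-mono Z⊆Y r)

  leave : ReachIn Z u w → u ∈ D → w ∉ D →
          Σ (Fin n) λ a → Σ (Fin n) λ b → a ∈ D × b ∈ Z × b ∉ D × Edge a b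
  leave (here _) u∈D w∉D = ⊥-elim (w∉D u∈D)
  leave {D = D} (step {u} {u′} _ e r) u∈D w∉D with u′ ∈? D
  ... | yes u′∈D = leave r u′∈D w∉D
  ... | no  u′∉D = u , u′ , u∈D , reach-start r , u′∉D , e

  connected-attach : Connected D → a ∈ D → Edge a y → Connected (D ∪ ⁅ y ⁆)
  connected-attach {D} {a} {y} ((d , d∈D) , walkD) a∈D e =
    (d , D⊆ d∈D) , walk
    where
    D⊆ : D ⊆ D ∪ ⁅ y ⁆
    D⊆ = p⊆p∪q ⁅ y ⁆
    y∈ : y ∈ D ∪ ⁅ y ⁆
    y∈ = x∈p∪q⁺ (inj₂ (x∈⁅x⁆ y))
    toA : ∀ u → u ∈ D ∪ ⁅ y ⁆ → ReachIn (D ∪ ⁅ y ⁆) u a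
    toA u u∈ with x∈p∪q⁻ D ⁅ y ⁆ u∈
    ... | inj₁ u∈D = reach-mono D⊆ (walkD u a u∈D a∈D)
    ... | inj₂ u∈⁅y⁆ rewrite x∈⁅y⁆⇒x≡y y u∈⁅y⁆ = step y∈ (Edge-sym e) (here (D⊆ a∈D))
    walk : ∀ u v → u ∈ D ∪ ⁅ y ⁆ → v ∈ D ∪ ⁅ y ⁆ → ReachIn (D ∪ ⁅ y ⁆) u v
    walk u v u∈ v∈ = reach-trans (toA u u∈) (reach-sym (toA v v∈))

  anticomplete : (∀ {x} → x ∈ A → x ∉ B) → (∀ {a b} → a ∈ A → b ∈ B → ¬ Edge a b) →
                 Anticomplete A B
  anticomplete {A} {B} disjoint noEdge =
    (λ (x , x∈A∩B) → let (x∈A , x∈B) = x∈p∩q⁻ A B x∈A∩B in disjoint x∈A x∈B) ,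
    (λ _ _ a∈A b∈B → noEdge a∈A b∈B)

  anticomplete-disjoint : Anticomplete A B → x ∈ A → x ∉ B
  anticomplete-disjoint (disjoint , _) x∈A x∈B = disjoint (_ , x∈p∩q⁺ (x∈A , x∈B))

  anticomplete-noEdge : Anticomplete A B → a ∈ A → b ∈ B → ¬ Edge a b
  anticomplete-noEdge (_ , noEdge) = noEdge _ _

  anticomplete-sym : Anticomplete A B → Anticomplete B A
  anticomplete-sym AB = anticomplete (λ x∈B x∈A → anticomplete-disjoint AB x∈A x∈B)
                                     (λ b∈B a∈A e → anticomplete-noEdge AB a∈A b∈B (Edge-sym e))

  anticomplete-∪ : Anticomplete A C → Anticomplete B C → Anticomplete (A ∪ B) C
  anticomplete-∪ {A} {C} {B} AC BC = anticomplete disjoint noEdge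
    where
    disjoint : ∀ {x} → x ∈ A ∪ B → x ∉ C
    disjoint x∈ with x∈p∪q⁻ A B x∈
    ... | inj₁ x∈A = anticomplete-disjoint AC x∈A
    ... | inj₂ x∈B = anticomplete-disjoint BC x∈B
    noEdge : ∀ {a c} → a ∈ A ∪ B → c ∈ C → ¬ Edge a c
    noEdge a∈ with x∈p∪q⁻ A B a∈
    ... | inj₁ a∈A = anticomplete-noEdge AC a∈A
    ... | inj₂ a∈B = anticomplete-noEdge BC a∈B

  anticomplete-⊆ : C ⊆ B → Anticomplete A B → Anticomplete A C
  anticomplete-⊆ C⊆B AB = anticomplete (λ x∈A x∈C → anticomplete-disjoint AB x∈A (C⊆B x∈C))
                                       (λ a∈A c∈C → anticomplete-noEdge AB a∈A (C⊆B c∈C))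

  record Component (Y C : Subset n) : Set where
    field
      C⊆Y       : C ⊆ Y
      connected : Connected C
      isolated  : Anticomplete C (Y ─ C)

  private
    grow : ∀ {Y v} R → Acc _⊃_ R → v ∈ R → R ⊆ Y → (∀ {u} → u ∈ R → ReachIn R u v) →
           Σ (Subset n) λ C → v ∈ C × Component Y C
    grow {Y} {v} R (acc larger) v∈R R⊆Y toV
      with any? (λ w → (w ∈? Y ─ R) ×-dec any? (λ u → (u ∈? R) ×-dec Edge? u w))
    ... | no noExit = R , v∈R , record
      { C⊆Y       = R⊆Y
      ; connected = (v , v∈R) , λ u w u∈R w∈R → reach-trans (toV u∈R) (reach-sym (toV w∈R))
      ; isolated  = anticomplete (λ x∈R x∈Y─R → proj₂ (x∈p─q⁻ Y R x∈Y─R) x∈R)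
                                 (λ a∈R b∈Y─R e → noExit (_ , b∈Y─R , _ , a∈R , e))
      }
    ... | yes (w , w∈Y─R , u , u∈R , e) = grow (R ∪ ⁅ w ⁆) (larger R⊂R′) (R⊆R′ v∈R) R′⊆Y toV′
      where
      R⊆R′ : R ⊆ R ∪ ⁅ w ⁆
      R⊆R′ = p⊆p∪q ⁅ w ⁆
      R⊂R′ : R ⊂ R ∪ ⁅ w ⁆
      R⊂R′ = R⊆R′ , w , x∈p∪q⁺ (inj₂ (x∈⁅x⁆ w)) , proj₂ (x∈p─q⁻ Y R w∈Y─R)
      R′⊆Y : R ∪ ⁅ w ⁆ ⊆ Y
      R′⊆Y x∈ with x∈p∪q⁻ R ⁅ w ⁆ x∈
      ... | inj₁ x∈R   = R⊆Y x∈R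
      ... | inj₂ x∈⁅w⁆ rewrite x∈⁅y⁆⇒x≡y w x∈⁅w⁆ = proj₁ (x∈p─q⁻ Y R w∈Y─R)
      toV′ : ∀ {x} → x ∈ R ∪ ⁅ w ⁆ → ReachIn (R ∪ ⁅ w ⁆) x v
      toV′ x∈ with x∈p∪q⁻ R ⁅ w ⁆ x∈
      ... | inj₁ x∈R   = reach-mono R⊆R′ (toV x∈R)
      ... | inj₂ x∈⁅w⁆ rewrite x∈⁅y⁆⇒x≡y w x∈⁅w⁆ =
        step x∈ (Edge-sym e) (reach-mono R⊆R′ (toV u∈R))

  component : ∀ {Y v} → v ∈ Y → Σ (Subset n) λ C → v ∈ C × Component Y C
  component {Y} {v} v∈Y = grow ⁅ v ⁆ (⊃-wellFounded ⁅ v ⁆) (x∈⁅x⁆ v) ⁅v⁆⊆Y toV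
    where
    ⁅v⁆⊆Y : ⁅ v ⁆ ⊆ Y
    ⁅v⁆⊆Y u∈ rewrite x∈⁅y⁆⇒x≡y v u∈ = v∈Y
    toV : ∀ {u} → u ∈ ⁅ v ⁆ → ReachIn ⁅ v ⁆ u v
    toV u∈ rewrite x∈⁅y⁆⇒x≡y v u∈ = here (x∈⁅x⁆ v)

  component-of-rest : Component Y C → Component (Y ─ C) D → Component Y D
  component-of-rest {Y} {C} {D} compC compD = record
    { C⊆Y       = proj₁ ∘ x∈p─q⁻ Y C ∘ D.C⊆Y
    ; connected = D.connected
    ; isolated  = anticomplete (λ x∈D x∈Y─D → proj₂ (x∈p─q⁻ Y D x∈Y─D) x∈D) noEdge
    }
    where
    module C = Component compC
    module D = Component compD
    noEdge : ∀ {a b} → a ∈ D → b ∈ Y ─ D → ¬ Edge a b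
    noEdge {a} {b} a∈D b∈Y─D e with x∈p─q⁻ Y D b∈Y─D | b ∈? C
    ... | _ , _ | yes b∈C = anticomplete-noEdge C.isolated b∈C (D.C⊆Y a∈D) (Edge-sym e)
    ... | b∈Y , b∉D | no b∉C =
      anticomplete-noEdge D.isolated a∈D (x∈p∧x∉q⇒x∈p─q (x∈p∧x∉q⇒x∈p─q b∈Y b∉C) b∉D) e

  attachment : Connected Z → x ∈ Z → Component (Z ─ N[ x ]) D →
               Σ (Fin n) λ y → y ∈ Z × Edge x y × Σ (Fin n) λ a → a ∈ D × Edge a y
  attachment {Z} {x} {D} (_ , walkZ) x∈Z compD
    with Component.connected compD
  ... | (d , d∈D) , _ with leave (walkZ d x (farZ d∈D) x∈Z) d∈D x∉D
    where
    farZ : ∀ {w} → w ∈ D → w ∈ Z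
    farZ = proj₁ ∘ far⁻ ∘ Component.C⊆Y compD
    x∉D : x ∉ D
    x∉D x∈D = proj₁ (proj₂ (far⁻ (Component.C⊆Y compD x∈D))) refl
  ... | a , b , a∈D , b∈Z , b∉D , e with Edge? x b | b ≟ᶠ x
  ...   | yes x~b | _      = b , b∈Z , x~b , a , a∈D , e
  ...   | no  _   | yes refl = ⊥-elim (proj₂ (proj₂ (far⁻ (Component.C⊆Y compD a∈D))) (Edge-sym e))
  ...   | no  x≁b | no b≢x =
    ⊥-elim (anticomplete-noEdge (Component.isolated compD) a∈D
                                (x∈p∧x∉q⇒x∈p─q (far⁺ b∈Z b≢x x≁b) b∉D) e)

  _[_↦_] : (ℕ → Fin n) → ℕ → Fin n → ℕ → Fin n
  (f [ k ↦ y ]) a with a ℕ.≟ k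
  ... | yes _ = y
  ... | no  _ = f a

  update-here : ∀ f k y → (f [ k ↦ y ]) k ≡ y
  update-here f k y with k ℕ.≟ k
  ... | yes _   = refl
  ... | no  k≢k = ⊥-elim (k≢k refl)

  update-elsewhere : ∀ f {k} y {a} → a ≢ k → (f [ k ↦ y ]) a ≡ f a
  update-elsewhere f {k} y {a} a≢k with a ℕ.≟ k
  ... | yes a≡k = ⊥-elim (a≢k a≡k)
  ... | no  _   = refl

  private
    ≤-suc-cases : ∀ {a j} → a ≤ suc j → a ≤ j ⊎ a ≡ suc j
    ≤-suc-cases a≤1+j with ℕP.m≤n⇒m<n∨m≡n a≤1+j
    ... | inj₁ a<1+j = inj₁ (ℕ.s≤s⁻¹ a<1+j)
    ... | inj₂ a≡1+j = inj₂ a≡1+j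

    <-suc-cases : ∀ {a j} → a < suc j → a < j ⊎ a ≡ j
    <-suc-cases a<1+j = ℕP.m≤n⇒m<n∨m≡n (ℕ.s≤s⁻¹ a<1+j)

  record IsPathUpTo (X : Subset n) (j : ℕ) (f : ℕ → Fin n) : Set where
    field
      inX         : ∀ {a} → a ≤ j → f a ∈ X
      injective   : ∀ {a b} → a ≤ j → b ≤ j → f a ≡ f b → a ≡ b
      induced     : ∀ {a b} → a ≤ j → b ≤ j → Edge (f a) (f b) → suc a ≡ b ⊎ suc b ≡ a
      consecutive : ∀ {a} → a < j → Edge (f a) (f (suc a))

  extend-path : ∀ {X j f y} → IsPathUpTo X j f → y ∈ X →
                (∀ {a} → a ≤ j → f a ≢ y) → Edge (f j) y →
                (∀ {a} → a < j → ¬ Edge (f a) y) →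
                IsPathUpTo X (suc j) (f [ suc j ↦ y ])
  extend-path {X} {j} {f} {y} P y∈X new≢old last~y earlier≁y = record
    { inX         = inX′
    ; injective   = injective′
    ; induced     = induced′
    ; consecutive = consecutive′
    }
    where
    open IsPathUpTo P
    f′ = f [ suc j ↦ y ]
    old : ∀ {a} → a ≤ j → f′ a ≡ f a
    old {a} a≤j = update-elsewhere f y λ { refl → ℕP.<-irrefl refl (s≤s a≤j) }
    new : f′ (suc j) ≡ y
    new = update-here f (suc j) y
    inX′ : ∀ {a} → a ≤ suc j → f′ a ∈ X
    inX′ a≤ with ≤-suc-cases a≤
    ... | inj₁ a≤j  = subst (_∈ X) (sym (old a≤j)) (inX a≤j)
    ... | inj₂ refl = subst (_∈ X) (sym new) y∈X
    injective′ : ∀ {a b} → a ≤ suc j → b ≤ suc j → f′ a ≡ f′ b → a ≡ b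
    injective′ a≤ b≤ eq with ≤-suc-cases a≤ | ≤-suc-cases b≤
    ... | inj₁ a≤j  | inj₁ b≤j  = injective a≤j b≤j (trans (sym (old a≤j)) (trans eq (old b≤j)))
    ... | inj₁ a≤j  | inj₂ refl = ⊥-elim (new≢old a≤j (trans (sym (old a≤j)) (trans eq new)))
    ... | inj₂ refl | inj₁ b≤j  = ⊥-elim (new≢old b≤j (trans (sym (old b≤j)) (trans (sym eq) new)))
    ... | inj₂ refl | inj₂ refl = refl
    toNew : ∀ {a} → a ≤ j → Edge (f a) y → suc a ≡ suc j
    toNew a≤j e with ℕP.m≤n⇒m<n∨m≡n a≤j
    ... | inj₁ a<j  = ⊥-elim (earlier≁y a<j e)
    ... | inj₂ refl = refl
    induced′ : ∀ {a b} → a ≤ suc j → b ≤ suc j → Edge (f′ a) (f′ b) → suc a ≡ b ⊎ suc b ≡ a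
    induced′ a≤ b≤ e with ≤-suc-cases a≤ | ≤-suc-cases b≤
    ... | inj₁ a≤j  | inj₁ b≤j  = induced a≤j b≤j (subst₂ Edge (old a≤j) (old b≤j) e)
    ... | inj₁ a≤j  | inj₂ refl = inj₁ (toNew a≤j (subst₂ Edge (old a≤j) new e))
    ... | inj₂ refl | inj₁ b≤j  = inj₂ (toNew b≤j (subst₂ Edge (old b≤j) new (Edge-sym e)))
    ... | inj₂ refl | inj₂ refl = ⊥-elim (Edge-irrefl e)
    consecutive′ : ∀ {a} → a < suc j → Edge (f′ a) (f′ (suc a))
    consecutive′ a< with <-suc-cases a<
    ... | inj₁ a<j  = subst₂ Edge (sym (old (ℕP.<⇒≤ a<j))) (sym (old a<j)) (consecutive a<j)
    ... | inj₂ refl = subst₂ Edge (sym (old ℕP.≤-refl)) (sym new) last~y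

  record IsSpireUpTo (X : Subset n) (j : ℕ) (f : ℕ → Fin n) (Z : Subset n) : Set where
    field
      path          : IsPathUpTo X j f
      Z⊆X           : Z ⊆ X
      earlierNotInZ : ∀ {a} → a < j → f a ∉ Z
      lastInZ       : f j ∈ Z
      earlierNoNbr  : ∀ {a z} → a < j → z ∈ Z → z ≢ f j → ¬ Edge (f a) z
      connected     : Connected Z

  extend-spire : ∀ {X j f Z D a y} → IsSpireUpTo X j f Z → D ⊆ Z ─ N[ f j ] →
                 Connected D → a ∈ D → Edge a y → y ∈ Z → Edge (f j) y →
                 IsSpireUpTo X (suc j) (f [ suc j ↦ y ]) (D ∪ ⁅ y ⁆)
  extend-spire {X} {j} {f} {Z} {D} {a} {y} S D⊆far connD a∈D a~y y∈Z last~y = record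
    { path          = extend-path path (Z⊆X y∈Z) new≢old last~y
                        (λ a<j → earlierNoNbr a<j y∈Z y≢last)
    ; Z⊆X           = Z⊆X ∘ Z′⊆Z
    ; earlierNotInZ = earlierNotInZ′
    ; lastInZ       = subst (_∈ D ∪ ⁅ y ⁆) (sym (update-here f (suc j) y)) y∈Z′
    ; earlierNoNbr  = earlierNoNbr′
    ; connected     = connected-attach connD a∈D a~y
    }
    where
    open IsSpireUpTo S
    f′ = f [ suc j ↦ y ]
    old : ∀ {b} → b ≤ j → f′ b ≡ f b
    old {b} b≤j = update-elsewhere f y λ { refl → ℕP.<-irrefl refl (s≤s b≤j) }
    y∈Z′ : y ∈ D ∪ ⁅ y ⁆
    y∈Z′ = x∈p∪q⁺ (inj₂ (x∈⁅x⁆ y))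
    Z′-cases : ∀ {z} → z ∈ D ∪ ⁅ y ⁆ → z ∈ D ⊎ z ≡ y
    Z′-cases z∈ with x∈p∪q⁻ D ⁅ y ⁆ z∈
    ... | inj₁ z∈D   = inj₁ z∈D
    ... | inj₂ z∈⁅y⁆ = inj₂ (x∈⁅y⁆⇒x≡y y z∈⁅y⁆)
    D-far : ∀ {z} → z ∈ D → z ∈ Z × z ≢ f j × ¬ Edge (f j) z
    D-far = far⁻ ∘ D⊆far
    Z′⊆Z : D ∪ ⁅ y ⁆ ⊆ Z
    Z′⊆Z z∈ with Z′-cases z∈
    ... | inj₁ z∈D  = proj₁ (D-far z∈D)
    ... | inj₂ refl = y∈Z
    y≢last : y ≢ f j
    y≢last refl = Edge-irrefl last~y
    new≢old : ∀ {b} → b ≤ j → f b ≢ y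
    new≢old b≤j with ℕP.m≤n⇒m<n∨m≡n b≤j
    ... | inj₁ b<j  = λ { refl → earlierNotInZ b<j y∈Z }
    ... | inj₂ refl = λ { refl → y≢last refl }
    earlierNotInZ′ : ∀ {b} → b < suc j → f′ b ∉ D ∪ ⁅ y ⁆
    earlierNotInZ′ {b} b< f′b∈ with Z′-cases (subst (_∈ D ∪ ⁅ y ⁆) (old (ℕ.s≤s⁻¹ b<)) f′b∈)
    ... | inj₂ fb≡y = new≢old (ℕ.s≤s⁻¹ b<) fb≡y
    ... | inj₁ fb∈D with <-suc-cases b<
    ...   | inj₁ b<j  = earlierNotInZ b<j (proj₁ (D-far fb∈D))
    ...   | inj₂ refl = proj₁ (proj₂ (D-far fb∈D)) refl
    earlierNoNbr′ : ∀ {b z} → b < suc j → z ∈ D ∪ ⁅ y ⁆ → z ≢ f′ (suc j) → ¬ Edge (f′ b) z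
    earlierNoNbr′ {b} {z} b< z∈ z≢new e with Z′-cases z∈
    ... | inj₂ z≡y = z≢new (trans z≡y (sym (update-here f (suc j) y)))
    ... | inj₁ z∈D with <-suc-cases b<
    ...   | inj₁ b<j  = earlierNoNbr b<j (proj₁ (D-far z∈D)) (proj₁ (proj₂ (D-far z∈D)))
                          (subst (λ v → Edge v z) (old (ℕP.<⇒≤ b<j)) e)
    ...   | inj₂ refl = proj₂ (proj₂ (D-far z∈D)) (subst (λ v → Edge v z) (old ℕP.≤-refl) e)

  spire-up-to⇒spire : ∀ {X t f Z} → IsSpireUpTo X t f Z → Spire X (suc t) (f ∘ toℕ) Z
  spire-up-to⇒spire {X} {t} {f} {Z} S = record
    { inducedPath = (inX ∘ bound) , (λ i k eq → toℕ-injective (injective (bound i) (bound k) eq)) ,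
                    (λ i k e → induced (bound i) (bound k) e) ,
                    (λ i k 1+i≡k → subst (λ b → Edge (f (toℕ i)) (f b)) 1+i≡k
                                     (consecutive (subst (_≤ t) (sym 1+i≡k) (bound k))))
    ; Z⊆X         = Z⊆X
    ; notInZ      = λ _ 1+i<1+t → earlierNotInZ (ℕ.s≤s⁻¹ 1+i<1+t)
    ; lastInZ     = λ _ 1+i≡1+t → subst (λ b → f b ∈ Z) (sym (ℕP.suc-injective 1+i≡1+t)) lastInZ
    ; noNbr       = λ _ z 1+i<1+t z∈Z z≢last → earlierNoNbr (ℕ.s≤s⁻¹ 1+i<1+t) z∈Z
                      (λ z≡ft → z≢last (Fin.fromℕ t) (cong suc (toℕ-fromℕ t))
                                  (trans z≡ft (cong f (sym (toℕ-fromℕ t)))))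
    ; connected   = connected
    }
    where
    open IsSpireUpTo S
    open IsPathUpTo path
    bound : (i : Fin (suc t)) → toℕ i ≤ t
    bound i = ℕ.s≤s⁻¹ (toℕ<n i)

module MassFacts {c ℓ₁ ℓ₂ : Level} {F : OrderedField c ℓ₁ ℓ₂} {n : ℕ} (m : Mass F n) where
  open OrderedField F renaming (refl to ≈-refl)
  open OrderedFieldFacts F
  open Mass m

  cover₂ : ∀ {T P Q} → (∀ {v} → v ∈ T → v ∈ P ⊎ v ∈ Q) → μ T ≤ μ P + μ Q
  cover₂ {T} {P} {Q} covered = begin
    μ T                ≤⟨ μ-mono T (P ∪ (Q ─ P)) T⊆ ⟩
    μ (P ∪ (Q ─ P))    ≤⟨ μ-subadd P (Q ─ P) disjoint ⟩
    μ P + μ (Q ─ P)    ≤⟨ +-mono-≤ (inj₂ ≈-refl) (μ-mono (Q ─ P) Q (p─q⊆p Q P)) ⟩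
    μ P + μ Q          ∎
    where
    T⊆ : T ⊆ P ∪ (Q ─ P)
    T⊆ {v} v∈T with covered v∈T | v ∈? P
    ... | _        | yes v∈P = x∈p∪q⁺ (inj₁ v∈P)
    ... | inj₁ v∈P | no  v∉P = ⊥-elim (v∉P v∈P)
    ... | inj₂ v∈Q | no  v∉P = x∈p∪q⁺ (inj₂ (x∈p∧x∉q⇒x∈p─q v∈Q v∉P))
    disjoint : Empty (P ∩ (Q ─ P))
    disjoint (v , v∈) = let (v∈P , v∈Q─P) = x∈p∩q⁻ P (Q ─ P) v∈ in proj₂ (x∈p─q⁻ Q P v∈Q─P) v∈P

  cover₃ : ∀ {T P Q R} → (∀ {v} → v ∈ T → v ∈ P ⊎ v ∈ Q ⊎ v ∈ R) → μ T ≤ μ P + (μ Q + μ R)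
  cover₃ {T} {P} {Q} {R} covered = begin
    μ T                  ≤⟨ cover₂ (Sum.map₂ (x∈p∪q⁺ {p = Q} {q = R}) ∘ covered) ⟩
    μ P + μ (Q ∪ R)      ≤⟨ +-mono-≤ (inj₂ ≈-refl) (cover₂ (x∈p∪q⁻ Q R)) ⟩
    μ P + (μ Q + μ R)    ∎

module Grouping {c ℓ₁ ℓ₂ : Level} (F : OrderedField c ℓ₁ ℓ₂) {n : ℕ}
    (G : Graph n) (m : Mass F n) (ε : OrderedField.Carrier F)
    (ε>0 : OrderedField._<_ F (OrderedField.0# F) ε)
    (noPair : ¬ (Σ (Subset n) λ A → Σ (Subset n) λ B → Graph.Anticomplete G A B
                 × OrderedField._≤_ F ε (Mass.μ m A) × OrderedField._≤_ F ε (Mass.μ m B)))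
  where
  open OrderedField F renaming (refl to ≈-refl; sym to ≈-sym; trans to ≈-trans)
  open OrderedFieldFacts F
  open Multiples ε
  open Graph G
  open GraphFacts G
  open Mass m
  open MassFacts m

  opposite-small : ∀ {A B} → Anticomplete A B → ε ≤ μ A → μ B < ε
  opposite-small {A} {B} AB ε≤μA with <-or-≥ (μ B) ε
  ... | inj₁ μB<ε = μB<ε
  ... | inj₂ ε≤μB = ⊥-elim (noPair (A , B , AB , ε≤μA , ε≤μB))

  BigComponent : Subset n → Set (ℓ₁ ⊔ ℓ₂)
  BigComponent Y = Σ (Subset n) λ D → Component Y D × ε ≤ μ D

  grouping : ∀ O Y → Anticomplete O Y → μ O < 2 ·ε → BigComponent Y ⊎ μ (O ∪ Y) < 3 ·ε
  grouping O Y = go Y (⊂-wellFounded Y) O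
    where
    go : ∀ Y → Acc _⊂_ Y → ∀ O → Anticomplete O Y → μ O < 2 ·ε →
         BigComponent Y ⊎ μ (O ∪ Y) < 3 ·ε
    go Y (acc smaller) O O-Y μO<2ε with <-or-≥ (μ O) ε
    -- O is heavy, so Y is light by (3)
    ... | inj₂ ε≤μO = inj₂ (begin-strict
      μ (O ∪ Y)   ≤⟨ cover₂ (x∈p∪q⁻ O Y) ⟩
      μ O + μ Y   <⟨ +-mono-<-≤ μO<2ε (inj₁ (opposite-small O-Y ε≤μO)) ⟩
      2 ·ε + ε    ≈⟨ ·ε-sucʳ 2 ⟩
      3 ·ε        ∎)
    ... | inj₁ μO<ε with nonempty? Y
    ...   | no Y-empty = inj₂ (begin-strict
      μ (O ∪ Y)   ≤⟨ μ-mono (O ∪ Y) O O∪Y⊆O ⟩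
      μ O         <⟨ μO<ε ⟩
      ε           ≈⟨ ·ε-one ⟨
      1 ·ε        ≤⟨ ·ε-mono ε>0 {1} {3} (s≤s z≤n) ⟩
      3 ·ε        ∎)
      where
      O∪Y⊆O : O ∪ Y ⊆ O
      O∪Y⊆O v∈ = Sum.[ (λ v∈O → v∈O) , (λ v∈Y → ⊥-elim (Y-empty (_ , v∈Y))) ] (x∈p∪q⁻ O Y v∈)
    -- take the component C of some v ∈ Y; if it is light, move it into O
    ...   | yes (v , v∈Y) with component v∈Y
    ...     | C , v∈C , compC with <-or-≥ (μ C) ε
    ...       | inj₂ ε≤μC = inj₁ (C , compC , ε≤μC)
    ...       | inj₁ μC<ε = Sum.map lift bound (go (Y ─ C) (smaller Y─C⊂Y) (O ∪ C) O∪C-rest μO∪C<2ε)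
      where
      Y─C⊂Y : Y ─ C ⊂ Y
      Y─C⊂Y = p∩q≢∅⇒p─q⊂p Y C (v , x∈p∩q⁺ (v∈Y , v∈C))
      O∪C-rest : Anticomplete (O ∪ C) (Y ─ C)
      O∪C-rest = anticomplete-∪ (anticomplete-⊆ (p─q⊆p Y C) O-Y) (Component.isolated compC)
      μO∪C<2ε : μ (O ∪ C) < 2 ·ε
      μO∪C<2ε = begin-strict
        μ (O ∪ C)   ≤⟨ cover₂ (x∈p∪q⁻ O C) ⟩
        μ O + μ C   <⟨ +-mono-<-≤ μO<ε (inj₁ μC<ε) ⟩
        ε + ε       ≈⟨ ε+ε≈2ε ⟩
        2 ·ε        ∎
      lift : BigComponent (Y ─ C) → BigComponent Y
      lift (D , compD , ε≤μD) = D , component-of-rest compC compD , ε≤μD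
      bound : μ ((O ∪ C) ∪ (Y ─ C)) < 3 ·ε → μ (O ∪ Y) < 3 ·ε
      bound = ≤-<-trans (μ-mono (O ∪ Y) _ (∪-transfer O Y C))

module Construction {c ℓ₁ ℓ₂ : Level} (F : OrderedField c ℓ₁ ℓ₂) {n : ℕ}
    (G : Graph n) (m : Mass F n) (ε : OrderedField.Carrier F)
    (ε>0 : OrderedField._<_ F (OrderedField.0# F) ε)
    (smallVertex : ∀ v → OrderedField._<_ F (Mass.μ m ⁅ v ⁆) ε)
    (smallNbhd : ∀ v → OrderedField._<_ F (Mass.μ m (Graph.N G v)) ε)
    (noPair : ¬ (Σ (Subset n) λ A → Σ (Subset n) λ B → Graph.Anticomplete G A B
                 × OrderedField._≤_ F ε (Mass.μ m A) × OrderedField._≤_ F ε (Mass.μ m B)))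
    (t : ℕ) (X : Subset n)
    (X-large : OrderedField._≤_ F (OrderedField._*_ F (OrderedField.fromℕ F (suc t ℕ.+ 2)) ε) (Mass.μ m X))
  where
  open OrderedField F renaming (refl to ≈-refl; sym to ≈-sym; trans to ≈-trans)
  open OrderedFieldFacts F
  open Multiples ε
  open Graph G
  open GraphFacts G
  open Mass m
  open MassFacts m
  open Grouping F G m ε ε>0 noPair

  τ : ℕ
  τ = suc t

  record Stage (j : ℕ) : Set (c ⊔ ℓ₁ ⊔ ℓ₂) where
    field
      f       : ℕ → Fin n
      Z A W   : Subset n
      spire   : IsSpireUpTo X j f Z
      A-small : μ A < ε
      A-anti  : Anticomplete A (Z ─ ⁅ f j ⁆)
      W-small : μ W ≤ j ·ε
      cover   : ∀ {v} → v ∈ X → v ∈ A ⊎ v ∈ W ⊎ v ∈ Z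

  X-not-small : ∀ {k} → k ℕ.≤ τ ℕ.+ 2 → ¬ (μ X < k ·ε)
  X-not-small k≤ μX<kε = ≤-<-contradiction (≤-trans (·ε-mono ε>0 k≤) X-large) μX<kε

  μ∅≈0 : μ ∅ ≈ 0 ·ε
  μ∅≈0 = ≈-trans μ-empty (≈-sym ·ε-zero)

  ∅-X : Anticomplete ∅ X
  ∅-X = anticomplete (λ x∈∅ _ → ∉⊥ x∈∅) (λ a∈∅ _ _ → ∉⊥ a∈∅)

  μ∅<2ε : μ ∅ < 2 ·ε
  μ∅<2ε = begin-strict
    μ ∅      ≈⟨ μ-empty ⟩
    0#       <⟨ ε>0 ⟩
    ε        ≈⟨ ·ε-one ⟨
    1 ·ε     ≤⟨ ·ε-mono ε>0 {1} {2} (s≤s z≤n) ⟩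
    2 ·ε     ∎

  -- Stage 0: by the grouping lemma G[X] has a component C of mass ≥ ε;
  -- the path is a single vertex x₀ ∈ C, Z = C and A = X ∖ C.
  initial-stage : Stage 0
  initial-stage with grouping ∅ X ∅-X μ∅<2ε
  ... | inj₂ μ∅∪X<3ε = ⊥-elim (X-not-small (s≤s (ℕP.m≤n+m 2 t))
                          (≤-<-trans (μ-mono X (∅ ∪ X) (x∈p∪q⁺ ∘ inj₂)) μ∅∪X<3ε))
  ... | inj₁ (C , compC , ε≤μC) = record
    { f       = λ _ → x₀
    ; Z       = C
    ; A       = X ─ C
    ; W       = ∅
    ; spire   = record
      { path          = record
        { inX         = λ _ → C⊆Y x₀∈C
        ; injective   = λ a≤0 b≤0 _ → trans (ℕP.n≤0⇒n≡0 a≤0) (sym (ℕP.n≤0⇒n≡0 b≤0))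
        ; induced     = λ _ _ e → ⊥-elim (Edge-irrefl e)
        ; consecutive = λ ()
        }
      ; Z⊆X           = C⊆Y
      ; earlierNotInZ = λ ()
      ; lastInZ       = x₀∈C
      ; earlierNoNbr  = λ ()
      ; connected     = connected
      }
    ; A-small = opposite-small isolated ε≤μC
    ; A-anti  = anticomplete-⊆ (p─q⊆p C ⁅ x₀ ⁆) (anticomplete-sym isolated)
    ; W-small = inj₂ μ∅≈0
    ; cover   = cover
    }
    where
    open Component compC
    x₀ : Fin n
    x₀ = proj₁ (proj₁ connected)
    x₀∈C : x₀ ∈ C
    x₀∈C = proj₂ (proj₁ connected)
    cover : ∀ {v} → v ∈ X → v ∈ X ─ C ⊎ v ∈ ∅ ⊎ v ∈ C
    cover {v} v∈X with v ∈? C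
    ... | yes v∈C = inj₂ (inj₂ v∈C)
    ... | no  v∉C = inj₁ (x∈p∧x∉q⇒x∈p─q v∈X v∉C)

  -- With x = x_j put O = A ∪ {x},
  -- Y = Z ∖ N[x] and W′ = W ∪ N(x), so that X ⊆ O ∪ W′ ∪ Y.  By the grouping
  -- lemma either O ∪ Y is light, making X too light, or G[Y] has a component
  -- D of mass ≥ ε; D is attached to x through a neighbour y ∈ Z of x, and
  -- the new stage has Z′ = D ∪ {y}, A′ = O ∪ (Y ∖ D) and W′.
  module Advance {j : ℕ} (j+1<τ : suc j ℕ.< τ) (S : Stage j) where
    open Stage S
    open IsSpireUpTo spire using (lastInZ; connected)

    x : Fin n
    x = f j

    O Y W′ : Subset n
    O  = A ∪ ⁅ x ⁆
    Y  = Z ─ N[ x ]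
    W′ = W ∪ N x

    O-Y : Anticomplete O Y
    O-Y = anticomplete-∪ (anticomplete-⊆ Y⊆Z─x A-anti) x-Y
      where
      Y⊆Z─x : Y ⊆ Z ─ ⁅ x ⁆
      Y⊆Z─x w∈Y = let (w∈Z , w≢x , _) = far⁻ w∈Y in x∈p∧x≢y⇒x∈p-y w∈Z w≢x
      x-Y : Anticomplete ⁅ x ⁆ Y
      x-Y = anticomplete
        (λ u∈⁅x⁆ u∈Y → proj₁ (proj₂ (far⁻ u∈Y)) (x∈⁅y⁆⇒x≡y x u∈⁅x⁆))
        (λ a∈⁅x⁆ b∈Y e → proj₂ (proj₂ (far⁻ b∈Y)) (subst (λ u → Edge u _) (x∈⁅y⁆⇒x≡y x a∈⁅x⁆) e))

    μO<2ε : μ O < 2 ·ε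
    μO<2ε = begin-strict
      μ O            ≤⟨ cover₂ (x∈p∪q⁻ A ⁅ x ⁆) ⟩
      μ A + μ ⁅ x ⁆  <⟨ +-mono-<-≤ A-small (inj₁ (smallVertex x)) ⟩
      ε + ε          ≈⟨ ε+ε≈2ε ⟩
      2 ·ε           ∎

    μW′≤ : μ W′ ≤ suc j ·ε
    μW′≤ = begin
      μ W′           ≤⟨ cover₂ (x∈p∪q⁻ W (N x)) ⟩
      μ W + μ (N x)  ≤⟨ +-mono-≤ W-small (inj₁ (smallNbhd x)) ⟩
      j ·ε + ε       ≈⟨ ·ε-sucʳ j ⟩
      suc j ·ε       ∎

    -- every vertex of Z is x, a neighbour of x, or far from x
    cover′ : ∀ {v} → v ∈ X → v ∈ O ⊎ v ∈ W′ ⊎ v ∈ Y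
    cover′ {v} v∈X with cover v∈X
    ... | inj₁ v∈A        = inj₁ (x∈p∪q⁺ (inj₁ v∈A))
    ... | inj₂ (inj₁ v∈W) = inj₂ (inj₁ (x∈p∪q⁺ (inj₁ v∈W)))
    ... | inj₂ (inj₂ v∈Z) with v ≟ᶠ x | Edge? x v
    ...   | yes refl | _       = inj₁ (x∈p∪q⁺ (inj₂ (x∈⁅x⁆ x)))
    ...   | no  _    | yes x~v = inj₂ (inj₁ (x∈p∪q⁺ (inj₂ (∈N⁺ x~v))))
    ...   | no  v≢x  | no  x≁v = inj₂ (inj₂ (far⁺ v∈Z v≢x x≁v))

    no-overflow : ¬ (μ (O ∪ Y) < 3 ·ε)
    no-overflow μO∪Y<3ε = X-not-small bound (begin-strict
      μ X                  ≤⟨ cover₂ X⊆ ⟩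
      μ (O ∪ Y) + μ W′     <⟨ +-mono-<-≤ μO∪Y<3ε μW′≤ ⟩
      3 ·ε + suc j ·ε      ≈⟨ ·ε-+ 3 (suc j) ⟨
      (3 ℕ.+ suc j) ·ε     ∎)
      where
      X⊆ : ∀ {v} → v ∈ X → v ∈ O ∪ Y ⊎ v ∈ W′
      X⊆ v∈X with cover′ v∈X
      ... | inj₁ v∈O         = inj₁ (x∈p∪q⁺ (inj₁ v∈O))
      ... | inj₂ (inj₁ v∈W′) = inj₂ v∈W′
      ... | inj₂ (inj₂ v∈Y)  = inj₁ (x∈p∪q⁺ (inj₂ v∈Y))
      bound : 3 ℕ.+ suc j ℕ.≤ τ ℕ.+ 2
      bound = ℕP.≤-trans (ℕP.+-monoʳ-≤ 3 (ℕ.s≤s⁻¹ j+1<τ)) (s≤s (ℕP.≤-reflexive (ℕP.+-comm 2 t)))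

    attach : BigComponent Y → Stage (suc j)
    attach (D , compD , ε≤μD) with attachment connected lastInZ compD
    ... | y , y∈Z , x~y , a , a∈D , a~y = record
      { f       = f′
      ; Z       = D ∪ ⁅ y ⁆
      ; A       = O ∪ (Y ─ D)
      ; W       = W′
      ; spire   = extend-spire spire D.C⊆Y D.connected a∈D a~y y∈Z x~y
      ; A-small = opposite-small (anticomplete-sym A′-D) ε≤μD
      ; A-anti  = anticomplete-⊆ Z′─y⊆D A′-D
      ; W-small = μW′≤
      ; cover   = cover″
      }
      where
      module D = Component compD
      f′ : ℕ → Fin n
      f′ = f [ suc j ↦ y ]
      A′-D : Anticomplete (O ∪ (Y ─ D)) D
      A′-D = anticomplete-∪ (anticomplete-⊆ D.C⊆Y O-Y) (anticomplete-sym D.isolated)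
      Z′─y⊆D : (D ∪ ⁅ y ⁆) ─ ⁅ f′ (suc j) ⁆ ⊆ D
      Z′─y⊆D {z} z∈ with x∈p─q⁻ (D ∪ ⁅ y ⁆) ⁅ f′ (suc j) ⁆ z∈
      ... | z∈Z′ , z≢new with x∈p∪q⁻ D ⁅ y ⁆ z∈Z′
      ...   | inj₁ z∈D   = z∈D
      ...   | inj₂ z∈⁅y⁆ = ⊥-elim (z≢new (subst (λ u → z ∈ ⁅ u ⁆) (sym (update-here f (suc j) y)) z∈⁅y⁆))
      cover″ : ∀ {v} → v ∈ X → v ∈ O ∪ (Y ─ D) ⊎ v ∈ W′ ⊎ v ∈ D ∪ ⁅ y ⁆
      cover″ {v} v∈X with cover′ v∈X
      ... | inj₁ v∈O        = inj₁ (x∈p∪q⁺ (inj₁ v∈O))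
      ... | inj₂ (inj₁ v∈W′) = inj₂ (inj₁ v∈W′)
      ... | inj₂ (inj₂ v∈Y) with v ∈? D
      ...   | yes v∈D = inj₂ (inj₂ (x∈p∪q⁺ (inj₁ v∈D)))
      ...   | no  v∉D = inj₁ (x∈p∪q⁺ (inj₂ (x∈p∧x∉q⇒x∈p─q v∈Y v∉D)))

    next-stage : Stage (suc j)
    next-stage = Sum.[ attach , ⊥-elim ∘ no-overflow ] (grouping O Y O-Y μO<2ε)

  stage : ∀ j → j ℕ.< τ → Stage j
  stage zero    _     = initial-stage
  stage (suc j) j+1<τ = Advance.next-stage j+1<τ (stage j (ℕP.<-trans (ℕP.n<1+n j) j+1<τ))

  final-mass : (S : Stage t) → μ X - τ ·ε ≤ μ (Stage.Z S)
  final-mass S = inj₁ (<-+⇒-< (begin-strict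
    μ X                  ≤⟨ cover₃ cover ⟩
    μ A + (μ W + μ Z)    <⟨ +-mono-<-≤ A-small (+-mono-≤ W-small (inj₂ ≈-refl)) ⟩
    ε + (t ·ε + μ Z)     ≈⟨ +-assoc ε (t ·ε) (μ Z) ⟨
    (ε + t ·ε) + μ Z     ≈⟨ +-cong (·ε-suc t) ≈-refl ⟨
    τ ·ε + μ Z           ∎))
    where open Stage S

-- The theorem.  The construction only needs τ ≥ 1; the hypothesis 3 ≤ τ
-- serves to exclude τ = 0.
mainTheorem7 : ∀ {c ℓ₁ ℓ₂ : Level} (F : OrderedField c ℓ₁ ℓ₂) {n : ℕ}
    (G : Graph n) (m : Mass F n) (ε : OrderedField.Carrier F) →
    OrderedField._<_ F (OrderedField.0# F) ε →
    (∀ v → OrderedField._<_ F (Mass.μ m ⁅ v ⁆) ε) →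
    (∀ v → OrderedField._<_ F (Mass.μ m (Graph.N G v)) ε) →
    ¬ (Σ (Subset n) λ A → Σ (Subset n) λ B → Graph.Anticomplete G A B
         × OrderedField._≤_ F ε (Mass.μ m A) × OrderedField._≤_ F ε (Mass.μ m B)) →
    (τ : ℕ) → 3 ℕ.≤ τ → (X : Subset n) →
    OrderedField._≤_ F (OrderedField._*_ F (OrderedField.fromℕ F (τ ℕ.+ 2)) ε) (Mass.μ m X) →
    Σ (Fin τ → Fin n) λ x → Σ (Subset n) λ Z → Graph.Spire G X τ x Z
      × OrderedField._≤_ F (OrderedField._-_ F (Mass.μ m X) (OrderedField._*_ F (OrderedField.fromℕ F τ) ε)) (Mass.μ m Z)
mainTheorem7 F G m ε ε>0 smallVertex smallNbhd noPair zero    () X X-large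
mainTheorem7 F G m ε ε>0 smallVertex smallNbhd noPair (suc t) _  X X-large =
  f ∘ toℕ , Z , GraphFacts.spire-up-to⇒spire G spire , final-mass last
  where
  open Construction F G m ε ε>0 smallVertex smallNbhd noPair t X X-large
  last : Stage t
  last = stage t (ℕP.n<1+n t)
  open Stage last
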